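{- Each of the following classes of delta-matroids is closed under taking minors and under taking duals: the Higgs lift delta-matroids, the full Higgs lift delta-matroids, and the even Higgs lift delta-matroids.
   Context: A set system is a pair $S=(E,\mathcal{F})$ with $E$ a finite set and $\mathcal{F}$ a collection of subsets of $E$; it is proper if $\mathcal{F}\neq\emptyset$. For proper $S$ and $e\in E$: $e$ is a loop if no feasible set contains $e$, a coloop if every feasible set contains $e$. If $e$ is not a loop, $S/e=(E-e,\{F-e: e\in F\in\mathcal{F}\})$; if $e$ is not a coloop, $S\backslash e=(E-e,\{F\in\mathcal{F}: e\notin F\})$; if $e$ is a loop or coloop, $S/e$ and $S\backslash e$ are both set equal to whichever of these was defined. A minor is any set system obtained by a (possibly empty) sequence of such operations. The dual of $S$ is $S^*=(E,\{E-F:F\in\mathcal{F}\})$. A delta-matroid is a proper set system such that for all $X,Y\in\mathcal{F}$ and $u\in X\triangle Y$ there is $v\in X\triangle Y$ (possibly $v=u$) with $X\triangle\{u,v\}\in\mathcal{F}$. For matroids $Q,L$ on $E$, $Q$ is a quotient of $L$ if there is a matroid $M$ and $X\subseteq E(M)$ with $M\backslash X=L$, $M/X=Q$. For such $Q,L$ and $0\le i\le k:=r(L)-r(Q)$, the Higgs lift $H^i_{Q,L}$ is the matroid on $E$ with rank function $r_i(X)=\min\{r_Q(X)+i,r_L(X)\}$. A delta-matroid $(E,\mathcal{F})$ is a Higgs lift delta-matroid if there exist such $Q,L$ and $K\subseteq\{0,\ldots,k\}$ with $\{0,\ldots,k\}-K$ containing no two consecutive integers and $\mathcal{F}=\bigcup_{i\in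 K}\mathcal{B}(H^i_{Q,L})$; it is a full Higgs lift delta-matroid if this holds with $K=\{0,1,\ldots,k\}$; it is an even Higgs lift delta-matroid if this holds with $k$ and all elements of $K$ even. -}

module Defs where

open import Data.Nat using (ℕ; zero; suc; _+_; _∸_; _≤_; _⊓_)
open import Data.Bool using (Bool; true; false)
open import Data.Fin using (Fin)
open import Data.Fin.Subset
  using (Subset; inside; outside; _∈_; _∉_; _⊆_; _∪_; _∩_; _─_; ∁; ⁅_⁆; ∣_∣; ⊤; ⊥)
open import Data.Vec using (Vec; _++_; insertAt)
open import Data.Product using (Σ; _×_; ∃; ∃-syntax)
open import Data.Sum using (_⊎_)
open import Relation.Nullary using (¬_)
open import Relation.Binary.PropositionalEquality using (_≡_)

Family : ℕ → Set₁
Family n = Subset n → Set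

_△_ : ∀ {n} → Subset n → Subset n → Subset n
X △ Y = (X ─ Y) ∪ (Y ─ X)

Proper : ∀ {n} → Family n → Set
Proper 𝓕 = ∃[ F ] 𝓕 F

IsDeltaMatroid : ∀ {n} → Family n → Set
IsDeltaMatroid {n} 𝓕 =
  Proper 𝓕 ×
  (∀ X Y → 𝓕 X → 𝓕 Y → ∀ (u : Fin n) → u ∈ (X △ Y) →
     ∃[ v ] (v ∈ (X △ Y) × 𝓕 (X △ (⁅ u ⁆ ∪ ⁅ v ⁆))))

dual : ∀ {n} → Family n → Family n
dual 𝓕 G = ∃[ F ] (𝓕 F × G ≡ ∁ F)

IsLoop : ∀ {n} → Family (suc n) → Fin (suc n) → Set
IsLoop 𝓕 e = ∀ F → 𝓕 F → e ∉ F

IsColoop : ∀ {n} → Family (suc n) → Fin (suc n) → Set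
IsColoop 𝓕 e = ∀ F → 𝓕 F → e ∈ F

-- The ground set E - e is identified with Fin n; a subset G of E - e
-- corresponds to insertAt G e outside (= G) and insertAt G e inside (= G + e).
-- {F - e : e ∈ F ∈ 𝓕}
contractFam : ∀ {n} → Family (suc n) → Fin (suc n) → Family n
contractFam 𝓕 e G = 𝓕 (insertAt G e inside)

deleteFam : ∀ {n} → Family (suc n) → Fin (suc n) → Family n
deleteFam 𝓕 e G = 𝓕 (insertAt G e outside)

data MinorStep {n : ℕ} (𝓕 : Family (suc n)) : Family n → Set₁ where
  contract      : ∀ e → Proper 𝓕 → ¬ IsLoop 𝓕 e → MinorStep 𝓕 (contractFam 𝓕 e)
  contractLoop  : ∀ e → Proper 𝓕 → IsLoop 𝓕 e → MinorStep 𝓕 (deleteFam 𝓕 e)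
  delete        : ∀ e → Proper 𝓕 → ¬ IsColoop 𝓕 e → MinorStep 𝓕 (deleteFam 𝓕 e)
  deleteColoop  : ∀ e → Proper 𝓕 → IsColoop 𝓕 e → MinorStep 𝓕 (contractFam 𝓕 e)

data Minor : ∀ {n m} → Family n → Family m → Set₁ where
  here : ∀ {n} {𝓕 : Family n} → Minor 𝓕 𝓕
  next : ∀ {n m} {𝓕 : Family (suc n)} {𝓖 : Family n} {𝓗 : Family m} →
         MinorStep 𝓕 𝓖 → Minor 𝓖 𝓗 → Minor 𝓕 𝓗

record Matroid (n : ℕ) : Set where
  field
    rank      : Subset n → ℕ
    rank-≤    : ∀ X → rank X ≤ ∣ X ∣
    rank-mono : ∀ X Y → X ⊆ Y → rank X ≤ rank Y
    rank-sub  : ∀ X Y → rank (X ∪ Y) + rank (X ∩ Y) ≤ rank X + rank Y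
open Matroid public

-- Q is a quotient of L: there is a matroid M on E ⊔ X (here Fin (n + m),
-- X = the last m elements) with M \ X = L and M / X = Q.
IsQuotient : ∀ {n} → Matroid n → Matroid n → Set
IsQuotient {n} Q L =
  ∃[ m ] Σ (Matroid (n + m)) λ M →
    (∀ Y → rank L Y ≡ rank M (Y ++ ⊥)) ×
    (∀ Y → rank Q Y ≡ rank M (Y ++ ⊤) ∸ rank M (⊥ {n} ++ ⊤))

liftGap : ∀ {n} → Matroid n → Matroid n → ℕ
liftGap Q L = rank L ⊤ ∸ rank Q ⊤

higgsRank : ∀ {n} → Matroid n → Matroid n → ℕ → Subset n → ℕ
higgsRank Q L i X = (rank Q X + i) ⊓ rank L X

IsBasisOf : ∀ {n} → (Subset n → ℕ) → Subset n → Set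
IsBasisOf r B = r B ≡ ∣ B ∣ × r B ≡ r ⊤

Even : ℕ → Set
Even k = ∃[ j ] k ≡ j + j

data Kind : Set where
  general full even : Kind

KCondition : Kind → ℕ → (ℕ → Bool) → Set
KCondition general k K =
  (∀ i → K i ≡ true → i ≤ k) ×
  (∀ i → suc i ≤ k → K i ≡ true ⊎ K (suc i) ≡ true)
KCondition full k K = ∀ i → (K i ≡ true → i ≤ k) × (i ≤ k → K i ≡ true)
KCondition even k K =
  KCondition general k K × Even k × (∀ i → K i ≡ true → Even i)

IsHiggsLiftDM : Kind → ∀ {n} → Family n → Set
IsHiggsLiftDM kind {n} 𝓕 =
  IsDeltaMatroid 𝓕 ×
  Σ (Matroid n) λ Q → Σ (Matroid n) λ L → IsQuotient Q L ×
  Σ (ℕ → Bool) λ K → KCondition kind (liftGap Q L) K ×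
  (∀ F → (𝓕 F → ∃[ i ] (K i ≡ true × IsBasisOf (higgsRank Q L i) F)) ×
         (∃[ i ] (K i ≡ true × IsBasisOf (higgsRank Q L i) F) → 𝓕 F))

{-# OPTIONS --safe #-}

-- Duality exchanges H^i_{Q,L} with H^{k-i}_{L*,Q*}, so dual 𝓕 is of the same kind with K reflected
-- in k. Deleting an element e that some member avoids keeps r(Q), and keeps at full rank exactly the
-- H^i with i ≤ k′ = r(L\e) - r(Q\e), where k′ ∈ {k - 1, k}; replacing L\e by the Higgs lift
-- H^c_{Q\e,L\e} for the largest admissible c ≤ k′ then realises 𝓕\e. Contraction is deletion
-- conjugated by duality, and the loop and coloop conventions of minors only ever delete an element
-- avoided by some member or contract one contained in some member.

module Submission where

open import Defs
open import Data.Bool using (Bool; true; not; _∧_; _∨_) renaming (_≟_ to _≟ᵇ_)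
open import Data.Bool.Properties using (∧-conicalˡ; ∧-conicalʳ; T-≡)
open import Data.Empty using (⊥-elim)
open import Data.Fin using (Fin; zero; suc; punchIn; punchOut; toℕ; fromℕ<) renaming (_≟_ to _≟ᶠ_)
open import Data.Fin.Properties using (punchIn-punchOut; toℕ-fromℕ<; any?)
open import Data.Fin.Subset
  using (Subset; inside; outside; _∈_; _∉_; _⊆_; _∪_; _∩_; _─_; ∁; ⁅_⁆; ∣_∣; ⊤; ⊥)
open import Data.Fin.Subset.Properties
import Algebra.Lattice.Properties.BooleanAlgebra as BA
open import Data.Nat using (ℕ; zero; suc; _+_; _*_; _∸_; _≤_; _⊓_; _≤ᵇ_; z≤n; s≤s; _≤?_)
open import Data.Nat.Properties
open import Algebra.Properties.CommutativeSemigroup +-commutativeSemigroup using (interchange)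
open import Data.Nat.Tactic.RingSolver using (solve-∀)
open import Data.Product using (_×_; _,_; proj₁; proj₂; ∃-syntax; map₂)
open import Data.Sum using (_⊎_; inj₁; inj₂; [_,_]) renaming (map to map-⊎)
open import Data.Vec using ([]; _∷_; _++_; insertAt; removeAt; lookup; take; drop; zipWith; here)
open import Data.Vec.Properties
  using ( map-insertAt; insertAt-removeAt; insertAt-lookup; insertAt-punchIn; lookup⇒[]=; []=⇒lookup
        ; zipWith-++; take++drop≡id; take-zipWith; drop-zipWith; ++-injectiveˡ; ++-injectiveʳ )
open import Function.Bundles using (Equivalence)
open import Relation.Nullary using (¬_; yes; no; Dec)
open import Relation.Nullary.Decidable using (_×-dec_; ¬?; map′; decidable-stable)
open import Relation.Binary.PropositionalEquality
  using (_≡_; _≢_; refl; sym; trans; cong; cong₂; subst; subst₂; module ≡-Reasoning)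

private variable
  n m : ℕ

∸+∸-mono-≤ : ∀ {a b c d r s} → r ≤ a → s ≤ b → r ≤ c → s ≤ d → a + b ≤ c + d →
             (a ∸ r) + (b ∸ s) ≤ (c ∸ r) + (d ∸ s)
∸+∸-mono-≤ {a} {b} {c} {d} {r} {s} r≤a s≤b r≤c s≤d a+b≤c+d =
  +-cancelʳ-≤ (r + s) _ _ (begin
    (a ∸ r) + (b ∸ s) + (r + s)   ≡⟨ restore r≤a s≤b ⟩
    a + b                         ≤⟨ a+b≤c+d ⟩
    c + d                         ≡⟨ restore r≤c s≤d ⟨
    (c ∸ r) + (d ∸ s) + (r + s)   ∎)
  where
  open ≤-Reasoning
  restore : ∀ {x y} → r ≤ x → s ≤ y → (x ∸ r) + (y ∸ s) + (r + s) ≡ x + y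
  restore {x} {y} r≤x s≤y =
    trans (interchange (x ∸ r) (y ∸ s) r s) (cong₂ _+_ (m∸n+n≡m r≤x) (m∸n+n≡m s≤y))

∸+∸≡∸ : ∀ {a b c} → a ≤ b → b ≤ c → (c ∸ b) + (b ∸ a) ≡ c ∸ a
∸+∸≡∸ {a} {b} {c} a≤b b≤c = begin
  (c ∸ b) + (b ∸ a)   ≡⟨ +-∸-assoc (c ∸ b) a≤b ⟨
  (c ∸ b) + b ∸ a     ≡⟨ cong (_∸ a) (m∸n+n≡m b≤c) ⟩
  c ∸ a               ∎
  where open ≡-Reasoning

half-mono-≤ : ∀ {a b} → a + a ≤ b + b → a ≤ b
half-mono-≤ {a} {b} 2a≤2b with a ≤? b
... | yes a≤b = a≤b
... | no a≰b = ⊥-elim (<⇒≱ (+-mono-< (≰⇒> a≰b) (≰⇒> a≰b)) 2a≤2b)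

even-∸ : ∀ {k d} → Even k → Even d → d ≤ k → Even (k ∸ d)
even-∸ (a , refl) (b , refl) d≤k =
  a ∸ b , (begin
    (a + a) ∸ (b + b)                       ≡⟨ cong₂ (λ x y → (x + y) ∸ (b + b)) a∸b+b≡a a∸b+b≡a ⟨
    ((a ∸ b) + b) + ((a ∸ b) + b) ∸ (b + b) ≡⟨ cong (_∸ (b + b)) (interchange (a ∸ b) b (a ∸ b) b) ⟩
    ((a ∸ b) + (a ∸ b)) + (b + b) ∸ (b + b) ≡⟨ m+n∸n≡m ((a ∸ b) + (a ∸ b)) (b + b) ⟩
    (a ∸ b) + (a ∸ b)                     ∎)
  where
  open ≡-Reasoning
  a∸b+b≡a : (a ∸ b) + b ≡ a
  a∸b+b≡a = m∸n+n≡m (half-mono-≤ {b} {a} d≤k)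

even-pred : ∀ {k} → Even (suc k) → ∃[ t ] k ≡ suc (t + t)
even-pred (zero , ())
even-pred (suc t , eq) = t , suc-injective (trans eq (cong suc (+-suc t t)))

even-≤-odd : ∀ s t → s + s ≤ suc (t + t) → s + s ≤ t + t
even-≤-odd s t 2s≤2t+1 with m≤n⇒m<n∨m≡n 2s≤2t+1
... | inj₁ 2s<2t+1 = m<1+n⇒m≤n 2s<2t+1
... | inj₂ 2s≡2t+1 = ⊥-elim (parity s t 2s≡2t+1)
  where
  parity : ∀ s t → s + s ≢ suc (t + t)
  parity s t eq = even≢odd s t (begin
    2 * s             ≡⟨ cong (s +_) (+-identityʳ s) ⟩
    s + s             ≡⟨ eq ⟩
    suc (t + t)       ≡⟨ cong (λ x → suc (t + x)) (+-identityʳ t) ⟨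
    suc (2 * t)       ∎)
    where open ≡-Reasoning

⊓+⊓-glb : ∀ {a x y z w} → a ≤ x + z → a ≤ x + w → a ≤ y + z → a ≤ y + w → a ≤ (x ⊓ y) + (z ⊓ w)
⊓+⊓-glb {a} {x} {y} {z} {w} a≤xz a≤xw a≤yz a≤yw =
  subst (a ≤_) (sym expand) (⊓-glb (⊓-glb a≤xz a≤xw) (⊓-glb a≤yz a≤yw))
  where
  expand : (x ⊓ y) + (z ⊓ w) ≡ ((x + z) ⊓ (x + w)) ⊓ ((y + z) ⊓ (y + w))
  expand = trans (+-distribʳ-⊓ (z ⊓ w) x y) (cong₂ _⊓_ (+-distribˡ-⊓ x z w) (+-distribˡ-⊓ y z w))

∁-involutive : (X : Subset n) → ∁ (∁ X) ≡ X
∁-involutive {n} = BA.¬-involutive (∪-∩-booleanAlgebra n)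

∁-∪ : (X Y : Subset n) → ∁ (X ∪ Y) ≡ ∁ X ∩ ∁ Y
∁-∪ {n} = BA.deMorgan₂ (∪-∩-booleanAlgebra n)

∁-∩ : (X Y : Subset n) → ∁ (X ∩ Y) ≡ ∁ X ∪ ∁ Y
∁-∩ {n} = BA.deMorgan₁ (∪-∩-booleanAlgebra n)

∁⊤≡⊥ : ∁ (⊤ {n}) ≡ ⊥
∁⊤≡⊥ {n} = BA.¬⊤≈⊥ (∪-∩-booleanAlgebra n)

p⊆q⇒p∩q≡p : {p q : Subset n} → p ⊆ q → p ∩ q ≡ p
p⊆q⇒p∩q≡p {p = p} {q} p⊆q = ⊆-antisym (p∩q⊆p p q) (λ x∈p → x∈p∩q⁺ (x∈p , p⊆q x∈p))

p⊆q⇒p∪q≡q : {p q : Subset n} → p ⊆ q → p ∪ q ≡ q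
p⊆q⇒p∪q≡q {p = p} {q} p⊆q =
  ⊆-antisym (λ x∈p∪q → [ p⊆q , (λ x∈q → x∈q) ] (x∈p∪q⁻ p q x∈p∪q)) (q⊆p∪q p q)

p∩q≡p⇒p⊆q : {p q : Subset n} → p ∩ q ≡ p → p ⊆ q
p∩q≡p⇒p⊆q {p = p} {q} eq = subst (_⊆ q) eq (p∩q⊆q p q)

∁p⊆∁q∪[q─p] : (p q : Subset n) → ∁ p ⊆ ∁ q ∪ (q ─ p)
∁p⊆∁q∪[q─p] p q {x} x∈∁p with x ∈? q
... | yes x∈q = q⊆p∪q (∁ q) (q ─ p) (x∈p∧x∉q⇒x∈p─q x∈q (x∈∁p⇒x∉p x∈∁p))
... | no x∉q = p⊆p∪q (q ─ p) (x∉p⇒x∈∁p x∉q)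

∣p∪q∣+∣p∩q∣≡∣p∣+∣q∣ : (p q : Subset n) → ∣ p ∪ q ∣ + ∣ p ∩ q ∣ ≡ ∣ p ∣ + ∣ q ∣
∣p∪q∣+∣p∩q∣≡∣p∣+∣q∣ [] [] = refl
∣p∪q∣+∣p∩q∣≡∣p∣+∣q∣ (inside ∷ p) (inside ∷ q) =
  cong suc (trans (+-suc _ _) (trans (cong suc (∣p∪q∣+∣p∩q∣≡∣p∣+∣q∣ p q)) (sym (+-suc _ _))))
∣p∪q∣+∣p∩q∣≡∣p∣+∣q∣ (inside ∷ p) (outside ∷ q) = cong suc (∣p∪q∣+∣p∩q∣≡∣p∣+∣q∣ p q)
∣p∪q∣+∣p∩q∣≡∣p∣+∣q∣ (outside ∷ p) (inside ∷ q) =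
  trans (cong suc (∣p∪q∣+∣p∩q∣≡∣p∣+∣q∣ p q)) (sym (+-suc _ _))
∣p∪q∣+∣p∩q∣≡∣p∣+∣q∣ (outside ∷ p) (outside ∷ q) = ∣p∪q∣+∣p∩q∣≡∣p∣+∣q∣ p q

p⊆q⇒∣p∣+∣q─p∣≡∣q∣ : {p q : Subset n} → p ⊆ q → ∣ p ∣ + ∣ q ─ p ∣ ≡ ∣ q ∣
p⊆q⇒∣p∣+∣q─p∣≡∣q∣ {p = []} {[]} _ = refl
p⊆q⇒∣p∣+∣q─p∣≡∣q∣ {p = inside ∷ p} {inside ∷ q} p⊆q =
  cong suc (p⊆q⇒∣p∣+∣q─p∣≡∣q∣ (drop-∷-⊆ p⊆q))
p⊆q⇒∣p∣+∣q─p∣≡∣q∣ {p = inside ∷ p} {outside ∷ q} p⊆q with p⊆q here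
... | ()
p⊆q⇒∣p∣+∣q─p∣≡∣q∣ {p = outside ∷ p} {inside ∷ q} p⊆q =
  trans (+-suc _ _) (cong suc (p⊆q⇒∣p∣+∣q─p∣≡∣q∣ (drop-∷-⊆ p⊆q)))
p⊆q⇒∣p∣+∣q─p∣≡∣q∣ {p = outside ∷ p} {outside ∷ q} p⊆q =
  p⊆q⇒∣p∣+∣q─p∣≡∣q∣ (drop-∷-⊆ p⊆q)

∁p△∁q≡p△q : (p q : Subset n) → ∁ p △ ∁ q ≡ p △ q
∁p△∁q≡p△q [] [] = refl
∁p△∁q≡p△q (inside ∷ p) (inside ∷ q) = cong (outside ∷_) (∁p△∁q≡p△q p q)
∁p△∁q≡p△q (inside ∷ p) (outside ∷ q) = cong (inside ∷_) (∁p△∁q≡p△q p q)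
∁p△∁q≡p△q (outside ∷ p) (inside ∷ q) = cong (inside ∷_) (∁p△∁q≡p△q p q)
∁p△∁q≡p△q (outside ∷ p) (outside ∷ q) = cong (outside ∷_) (∁p△∁q≡p△q p q)

∁p△q≡∁[p△q] : (p q : Subset n) → ∁ p △ q ≡ ∁ (p △ q)
∁p△q≡∁[p△q] [] [] = refl
∁p△q≡∁[p△q] (inside ∷ p) (inside ∷ q) = cong (inside ∷_) (∁p△q≡∁[p△q] p q)
∁p△q≡∁[p△q] (inside ∷ p) (outside ∷ q) = cong (outside ∷_) (∁p△q≡∁[p△q] p q)
∁p△q≡∁[p△q] (outside ∷ p) (inside ∷ q) = cong (outside ∷_) (∁p△q≡∁[p△q] p q)
∁p△q≡∁[p△q] (outside ∷ p) (outside ∷ q) = cong (inside ∷_) (∁p△q≡∁[p△q] p q)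

insertAt-zipWith : (f : Bool → Bool → Bool) (X Y : Subset n) (e : Fin (suc n)) (a b : Bool) →
                   zipWith f (insertAt X e a) (insertAt Y e b) ≡ insertAt (zipWith f X Y) e (f a b)
insertAt-zipWith f X Y zero a b = refl
insertAt-zipWith f (x ∷ X) (y ∷ Y) (suc e) a b = cong (f x y ∷_) (insertAt-zipWith f X Y e a b)

insertAt-∪ : (X Y : Subset n) (e : Fin (suc n)) →
             insertAt X e outside ∪ insertAt Y e outside ≡ insertAt (X ∪ Y) e outside
insertAt-∪ X Y e = insertAt-zipWith _∨_ X Y e outside outside

insertAt-∩ : (X Y : Subset n) (e : Fin (suc n)) →
             insertAt X e outside ∩ insertAt Y e outside ≡ insertAt (X ∩ Y) e outside
insertAt-∩ X Y e = insertAt-zipWith _∧_ X Y e outside outside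

insertAt-△ : (X Y : Subset n) (e : Fin (suc n)) →
             insertAt X e outside △ insertAt Y e outside ≡ insertAt (X △ Y) e outside
insertAt-△ X Y e =
  trans (cong₂ _∪_ (insertAt-zipWith _ X Y e outside outside)
                    (insertAt-zipWith _ Y X e outside outside))
        (insertAt-∪ (X ─ Y) (Y ─ X) e)

insertAt-⊆ : {X Y : Subset n} (e : Fin (suc n)) → X ⊆ Y → insertAt X e outside ⊆ insertAt Y e outside
insertAt-⊆ {X = X} {Y} e X⊆Y =
  p∩q≡p⇒p⊆q (trans (insertAt-∩ X Y e) (cong (λ Z → insertAt Z e outside) (p⊆q⇒p∩q≡p X⊆Y)))

∣insertAt-outside∣ : (X : Subset n) (e : Fin (suc n)) → ∣ insertAt X e outside ∣ ≡ ∣ X ∣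
∣insertAt-outside∣ X zero = refl
∣insertAt-outside∣ (inside ∷ X) (suc e) = cong suc (∣insertAt-outside∣ X e)
∣insertAt-outside∣ (outside ∷ X) (suc e) = ∣insertAt-outside∣ X e

insertAt-⊥ : (e : Fin (suc n)) → insertAt (⊥ {n}) e outside ≡ ⊥
insertAt-⊥ zero = refl
insertAt-⊥ {suc n} (suc e) = cong (outside ∷_) (insertAt-⊥ e)

insertAt-⊤∪⁅e⁆ : (e : Fin (suc n)) → insertAt (⊤ {n}) e outside ∪ ⁅ e ⁆ ≡ ⊤
insertAt-⊤∪⁅e⁆ {n} zero = cong (inside ∷_) (∪-identityʳ ⊤)
insertAt-⊤∪⁅e⁆ {suc n} (suc e) = cong (inside ∷_) (insertAt-⊤∪⁅e⁆ e)

⁅punchIn⁆≡insertAt⁅⁆ : (e : Fin (suc n)) (u : Fin n) → ⁅ punchIn e u ⁆ ≡ insertAt ⁅ u ⁆ e outside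
⁅punchIn⁆≡insertAt⁅⁆ zero u = refl
⁅punchIn⁆≡insertAt⁅⁆ (suc e) zero = cong (inside ∷_) (sym (insertAt-⊥ e))
⁅punchIn⁆≡insertAt⁅⁆ (suc e) (suc u) = cong (outside ∷_) (⁅punchIn⁆≡insertAt⁅⁆ e u)

punchIn-∈-insertAt⁺ : {X : Subset n} (e : Fin (suc n)) (a : Bool) {u : Fin n} →
                      u ∈ X → punchIn e u ∈ insertAt X e a
punchIn-∈-insertAt⁺ {X = X} e a {u} u∈X =
  lookup⇒[]= (punchIn e u) _ (trans (insertAt-punchIn X e a u) ([]=⇒lookup u∈X))

punchIn-∈-insertAt⁻ : {X : Subset n} (e : Fin (suc n)) (a : Bool) {u : Fin n} →
                      punchIn e u ∈ insertAt X e a → u ∈ X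
punchIn-∈-insertAt⁻ {X = X} e a {u} pu∈ =
  lookup⇒[]= u X (trans (sym (insertAt-punchIn X e a u)) ([]=⇒lookup pu∈))

e∉insertAt-outside : (X : Subset n) (e : Fin (suc n)) → e ∉ insertAt X e outside
e∉insertAt-outside X e e∈ with trans (sym ([]=⇒lookup e∈)) (insertAt-lookup X e outside)
... | ()

insertAt-removeAt-outside : {F : Subset (suc n)} (e : Fin (suc n)) → e ∉ F →
                            insertAt (removeAt F e) e outside ≡ F
insertAt-removeAt-outside {F = F} e e∉F with lookup F e in eq
... | inside = ⊥-elim (e∉F (lookup⇒[]= e F eq))
... | outside = trans (cong (insertAt (removeAt F e) e) (sym eq)) (insertAt-removeAt F e)

rank-⊥ : (M : Matroid n) → rank M ⊥ ≡ 0
rank-⊥ {n} M = n≤0⇒n≡0 (subst (rank M ⊥ ≤_) (∣⊥∣≡0 n) (rank-≤ M ⊥))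

rank-∪-≤ : (M : Matroid n) (X Y : Subset n) → rank M (X ∪ Y) ≤ rank M X + rank M Y
rank-∪-≤ M X Y = ≤-trans (m≤m+n _ _) (rank-sub M X Y)

rank-≤-rank-⊤ : (M : Matroid n) (X : Subset n) → rank M X ≤ rank M ⊤
rank-≤-rank-⊤ M X = rank-mono M X ⊤ ⊆⊤

rank-⊤-≤-n : (M : Matroid n) → rank M ⊤ ≤ n
rank-⊤-≤-n {n} M = subst (rank M ⊤ ≤_) (∣⊤∣≡n n) (rank-≤ M ⊤)

rank-⊤≤∣X∣+rank-∁X : (M : Matroid n) (X : Subset n) → rank M ⊤ ≤ ∣ X ∣ + rank M (∁ X)
rank-⊤≤∣X∣+rank-∁X M X = begin
  rank M ⊤                   ≡⟨ cong (rank M) (p∪∁p≡⊤ X) ⟨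
  rank M (X ∪ ∁ X)           ≤⟨ rank-∪-≤ M X (∁ X) ⟩
  rank M X + rank M (∁ X)    ≤⟨ +-monoˡ-≤ (rank M (∁ X)) (rank-≤ M X) ⟩
  ∣ X ∣ + rank M (∁ X)       ∎
  where open ≤-Reasoning

IsBasisOf-cong : {f g : Subset n → ℕ} → (∀ X → f X ≡ g X) → ∀ {B} → IsBasisOf f B → IsBasisOf g B
IsBasisOf-cong f≗g {B} (fB≡∣B∣ , fB≡f⊤) =
  trans (sym (f≗g B)) fB≡∣B∣ , trans (sym (f≗g B)) (trans fB≡f⊤ (f≗g ⊤))

-- The rank-increment form of IsQuotient (see isQuotient⇒≼ and ≼⇒isQuotient).
record _≼_ (Q L : Matroid n) : Set where
  constructor ≼-intro
  field
    increment-≤ : ∀ A B → A ⊆ B → rank Q B + rank L A ≤ rank Q A + rank L B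
open _≼_

≼⇒rank-≤ : {Q L : Matroid n} → Q ≼ L → ∀ X → rank Q X ≤ rank L X
≼⇒rank-≤ {Q = Q} {L} Q≼L X = +-cancelʳ-≤ 0 (rank Q X) (rank L X) (begin
  rank Q X + 0          ≡⟨ cong (rank Q X +_) (rank-⊥ L) ⟨
  rank Q X + rank L ⊥   ≤⟨ increment-≤ Q≼L ⊥ X ⊥⊆ ⟩
  rank Q ⊥ + rank L X   ≡⟨ cong (_+ rank L X) (rank-⊥ Q) ⟩
  rank L X              ≡⟨ +-identityʳ (rank L X) ⟨
  rank L X + 0          ∎)
  where open ≤-Reasoning

≼-∪∩ : {Q L : Matroid n} → Q ≼ L → ∀ X Y → rank Q (X ∪ Y) + rank L (X ∩ Y) ≤ rank Q X + rank L Y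
≼-∪∩ {Q = Q} {L} Q≼L X Y = +-cancelʳ-≤ (q (X ∩ Y) + q Y) _ _ (begin
  (q (X ∪ Y) + l (X ∩ Y)) + (q (X ∩ Y) + q Y)
    ≡⟨ shuffle (q (X ∪ Y)) (l (X ∩ Y)) (q (X ∩ Y)) (q Y) ⟩
  (q (X ∪ Y) + q (X ∩ Y)) + (q Y + l (X ∩ Y))
    ≤⟨ +-mono-≤ (rank-sub Q X Y) (increment-≤ Q≼L (X ∩ Y) Y (p∩q⊆q X Y)) ⟩
  (q X + q Y) + (q (X ∩ Y) + l Y)
    ≡⟨ shuffle′ (q X) (q Y) (q (X ∩ Y)) (l Y) ⟩
  (q X + l Y) + (q (X ∩ Y) + q Y)
    ∎)
  where
  open ≤-Reasoning
  q = rank Q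
  l = rank L
  shuffle : ∀ a b c d → (a + b) + (c + d) ≡ (a + c) + (d + b)
  shuffle = solve-∀
  shuffle′ : ∀ a b c d → (a + b) + (c + d) ≡ (a + d) + (c + b)
  shuffle′ = solve-∀

liftGap≤⇒+≤ : {Q L : Matroid n} → Q ≼ L → ∀ {i} → i ≤ liftGap Q L → rank Q ⊤ + i ≤ rank L ⊤
liftGap≤⇒+≤ {Q = Q} {L} Q≼L {i} i≤k =
  subst (_≤ rank L ⊤) (+-comm i (rank Q ⊤)) (m≤o∸n⇒m+n≤o i (≼⇒rank-≤ Q≼L ⊤) i≤k)

-- Higgs lifts

module _ {Q L : Matroid n} (Q≼L : Q ≼ L) (c : ℕ) where

  private
    h q l : Subset n → ℕ
    h = higgsRank Q L c
    q = rank Q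
    l = rank L
    h≤q+c : ∀ X → h X ≤ q X + c
    h≤q+c X = m⊓n≤m (q X + c) (l X)
    h≤l : ∀ X → h X ≤ l X
    h≤l X = m⊓n≤n (q X + c) (l X)

  higgsRank-∪∩-≤-rank-Q+rank-L : ∀ X Y → h (X ∪ Y) + h (X ∩ Y) ≤ (q X + c) + l Y
  higgsRank-∪∩-≤-rank-Q+rank-L X Y = begin
    h (X ∪ Y) + h (X ∩ Y)          ≤⟨ +-mono-≤ (h≤q+c (X ∪ Y)) (h≤l (X ∩ Y)) ⟩
    (q (X ∪ Y) + c) + l (X ∩ Y)    ≡⟨ +-comm-middle (q (X ∪ Y)) c (l (X ∩ Y)) ⟩
    (q (X ∪ Y) + l (X ∩ Y)) + c    ≤⟨ +-monoˡ-≤ c (≼-∪∩ Q≼L X Y) ⟩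
    (q X + l Y) + c                ≡⟨ +-comm-middle (q X) c (l Y) ⟨
    (q X + c) + l Y                ∎
    where
    open ≤-Reasoning
    +-comm-middle : ∀ a b d → (a + b) + d ≡ (a + d) + b
    +-comm-middle = solve-∀

  higgsRank-submodular : ∀ X Y → h (X ∪ Y) + h (X ∩ Y) ≤ h X + h Y
  higgsRank-submodular X Y =
    ⊓+⊓-glb {x = q X + c} {l X} {q Y + c} {l Y}
            bound-QQ (higgsRank-∪∩-≤-rank-Q+rank-L X Y) bound-LQ bound-LL
    where
    open ≤-Reasoning
    bound-QQ : h (X ∪ Y) + h (X ∩ Y) ≤ (q X + c) + (q Y + c)
    bound-QQ = begin
      h (X ∪ Y) + h (X ∩ Y)                 ≤⟨ +-mono-≤ (h≤q+c (X ∪ Y)) (h≤q+c (X ∩ Y)) ⟩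
      (q (X ∪ Y) + c) + (q (X ∩ Y) + c)     ≡⟨ interchange (q (X ∪ Y)) c (q (X ∩ Y)) c ⟩
      (q (X ∪ Y) + q (X ∩ Y)) + (c + c)     ≤⟨ +-monoˡ-≤ (c + c) (rank-sub Q X Y) ⟩
      (q X + q Y) + (c + c)                 ≡⟨ interchange (q X) (q Y) c c ⟩
      (q X + c) + (q Y + c)                 ∎
    bound-LQ : h (X ∪ Y) + h (X ∩ Y) ≤ l X + (q Y + c)
    bound-LQ = begin
      h (X ∪ Y) + h (X ∩ Y)    ≡⟨ cong₂ (λ U I → h U + h I) (∪-comm X Y) (∩-comm X Y) ⟩
      h (Y ∪ X) + h (Y ∩ X)    ≤⟨ higgsRank-∪∩-≤-rank-Q+rank-L Y X ⟩
      (q Y + c) + l X          ≡⟨ +-comm (q Y + c) (l X) ⟩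
      l X + (q Y + c)          ∎
    bound-LL : h (X ∪ Y) + h (X ∩ Y) ≤ l X + l Y
    bound-LL = ≤-trans (+-mono-≤ (h≤l (X ∪ Y)) (h≤l (X ∩ Y))) (rank-sub L X Y)

  higgsLift : Matroid n
  higgsLift = record
    { rank      = h
    ; rank-≤    = λ X → ≤-trans (h≤l X) (rank-≤ L X)
    ; rank-mono = λ X Y X⊆Y → ⊓-mono-≤ (+-monoˡ-≤ c (rank-mono Q X Y X⊆Y)) (rank-mono L X Y X⊆Y)
    ; rank-sub  = higgsRank-submodular
    }

  ≼-higgsLift : Q ≼ higgsLift
  ≼-higgsLift = ≼-intro λ A B A⊆B → begin
    q B + h A
      ≤⟨ ⊓-glb (+-monoʳ-≤ (q B) (h≤q+c A)) (+-monoʳ-≤ (q B) (h≤l A)) ⟩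
    (q B + (q A + c)) ⊓ (q B + l A)
      ≤⟨ ⊓-mono-≤ (≤-reflexive (x+[y+z]≡y+[x+z] (q B) (q A) c)) (increment-≤ Q≼L A B A⊆B) ⟩
    (q A + (q B + c)) ⊓ (q A + l B)
      ≡⟨ +-distribˡ-⊓ (q A) (q B + c) (l B) ⟨
    q A + h B
      ∎
    where
    open ≤-Reasoning
    x+[y+z]≡y+[x+z] : ∀ x y z → x + (y + z) ≡ y + (x + z)
    x+[y+z]≡y+[x+z] = solve-∀

module _ {Q L : Matroid n} (Q≼L : Q ≼ L) where

  higgsRank-⊤ : ∀ {i} → i ≤ liftGap Q L → higgsRank Q L i ⊤ ≡ rank Q ⊤ + i
  higgsRank-⊤ i≤k = m≤n⇒m⊓n≡m (liftGap≤⇒+≤ Q≼L i≤k)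

  liftGap-higgsLift : ∀ {c} → c ≤ liftGap Q L → liftGap Q (higgsLift Q≼L c) ≡ c
  liftGap-higgsLift {c} c≤k = trans (cong (_∸ rank Q ⊤) (higgsRank-⊤ c≤k)) (m+n∸m≡n (rank Q ⊤) c)

  higgsRank-higgsLift : ∀ {i c} → i ≤ c → ∀ X → higgsRank Q (higgsLift Q≼L c) i X ≡ higgsRank Q L i X
  higgsRank-higgsLift {i} {c} i≤c X =
    trans (sym (⊓-assoc (rank Q X + i) (rank Q X + c) (rank L X)))
          (cong (_⊓ rank L X) (m≤n⇒m⊓n≡m (+-monoʳ-≤ (rank Q X) i≤c)))

-- Dual matroids

dualMatroid : Matroid n → Matroid n
dualMatroid M = record
  { rank      = dualRank
  ; rank-≤    = dualRank-≤
  ; rank-mono = λ S T S⊆T → ∸-monoˡ-≤ (rank M ⊤) (∣∣+rank-∁-mono S⊆T)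
  ; rank-sub  = dualRank-submodular
  }
  where
  dualRank : Subset _ → ℕ
  dualRank X = (∣ X ∣ + rank M (∁ X)) ∸ rank M ⊤

  dualRank-≤ : ∀ X → dualRank X ≤ ∣ X ∣
  dualRank-≤ X = begin
    (∣ X ∣ + rank M (∁ X)) ∸ rank M ⊤   ≤⟨ ∸-monoˡ-≤ (rank M ⊤) (+-monoʳ-≤ ∣ X ∣ (rank-≤-rank-⊤ M _)) ⟩
    (∣ X ∣ + rank M ⊤) ∸ rank M ⊤       ≡⟨ m+n∸n≡m ∣ X ∣ (rank M ⊤) ⟩
    ∣ X ∣                               ∎
    where open ≤-Reasoning

  ∣∣+rank-∁-mono : ∀ {S T} → S ⊆ T → ∣ S ∣ + rank M (∁ S) ≤ ∣ T ∣ + rank M (∁ T)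
  ∣∣+rank-∁-mono {S} {T} S⊆T = begin
    ∣S∣ + rank M (∁ S)                    ≤⟨ +-monoʳ-≤ ∣S∣ (rank-mono M _ _ (∁p⊆∁q∪[q─p] S T)) ⟩
    ∣S∣ + rank M (∁ T ∪ (T ─ S))          ≤⟨ +-monoʳ-≤ ∣S∣ (rank-∪-≤ M (∁ T) (T ─ S)) ⟩
    ∣S∣ + (rank M (∁ T) + rank M (T ─ S)) ≤⟨ +-monoʳ-≤ ∣S∣ (+-monoʳ-≤ (rank M (∁ T)) (rank-≤ M _)) ⟩
    ∣S∣ + (rank M (∁ T) + ∣T─S∣)          ≡⟨ x+[y+z]≡[x+z]+y ∣S∣ (rank M (∁ T)) ∣T─S∣ ⟩
    (∣S∣ + ∣T─S∣) + rank M (∁ T)          ≡⟨ cong (_+ rank M (∁ T)) (p⊆q⇒∣p∣+∣q─p∣≡∣q∣ S⊆T) ⟩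
    ∣ T ∣ + rank M (∁ T)                  ∎
    where
    open ≤-Reasoning
    x+[y+z]≡[x+z]+y : ∀ x y z → x + (y + z) ≡ (x + z) + y
    x+[y+z]≡[x+z]+y = solve-∀
    ∣S∣ ∣T─S∣ : ℕ
    ∣S∣ = ∣ S ∣
    ∣T─S∣ = ∣ T ─ S ∣

  dualRank-submodular : ∀ X Y → dualRank (X ∪ Y) + dualRank (X ∩ Y) ≤ dualRank X + dualRank Y
  dualRank-submodular X Y =
    ∸+∸-mono-≤ (rank-⊤≤∣X∣+rank-∁X M (X ∪ Y)) (rank-⊤≤∣X∣+rank-∁X M (X ∩ Y))
               (rank-⊤≤∣X∣+rank-∁X M X) (rank-⊤≤∣X∣+rank-∁X M Y) (begin
      (∣ X ∪ Y ∣ + r (∁ (X ∪ Y))) + (∣ X ∩ Y ∣ + r (∁ (X ∩ Y)))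
        ≡⟨ cong₂ (λ U I → (∣ X ∪ Y ∣ + r U) + (∣ X ∩ Y ∣ + r I)) (∁-∪ X Y) (∁-∩ X Y) ⟩
      (∣ X ∪ Y ∣ + r (∁ X ∩ ∁ Y)) + (∣ X ∩ Y ∣ + r (∁ X ∪ ∁ Y))
        ≡⟨ shuffle (∣ X ∪ Y ∣) (r (∁ X ∩ ∁ Y)) (∣ X ∩ Y ∣) (r (∁ X ∪ ∁ Y)) ⟩
      (∣ X ∪ Y ∣ + ∣ X ∩ Y ∣) + (r (∁ X ∪ ∁ Y) + r (∁ X ∩ ∁ Y))
        ≤⟨ +-mono-≤ (≤-reflexive (∣p∪q∣+∣p∩q∣≡∣p∣+∣q∣ X Y)) (rank-sub M (∁ X) (∁ Y)) ⟩
      (∣ X ∣ + ∣ Y ∣) + (r (∁ X) + r (∁ Y))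
        ≡⟨ interchange (∣ X ∣) (∣ Y ∣) (r (∁ X)) (r (∁ Y)) ⟩
      (∣ X ∣ + r (∁ X)) + (∣ Y ∣ + r (∁ Y)) ∎)
    where
    open ≤-Reasoning
    r : Subset _ → ℕ
    r = rank M
    shuffle : ∀ a b c d → (a + b) + (c + d) ≡ (a + c) + (d + b)
    shuffle = solve-∀

rank-dual-⊤ : (M : Matroid n) → rank (dualMatroid M) ⊤ ≡ n ∸ rank M ⊤
rank-dual-⊤ {n} M = cong (_∸ rank M ⊤) (begin
  ∣ ⊤ {n} ∣ + rank M (∁ ⊤)   ≡⟨ cong₂ _+_ (∣⊤∣≡n n) (cong (rank M) ∁⊤≡⊥) ⟩
  n + rank M ⊥               ≡⟨ cong (n +_) (rank-⊥ M) ⟩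
  n + 0                      ≡⟨ +-identityʳ n ⟩
  n                          ∎)
  where open ≡-Reasoning

≼-dual : {Q L : Matroid n} → Q ≼ L → dualMatroid L ≼ dualMatroid Q
≼-dual {Q = Q} {L} Q≼L = ≼-intro increment-≤-dual
  where
  q l : Subset _ → ℕ
  q = rank Q
  l = rank L
  increment-≤-dual : ∀ A B → A ⊆ B →
    rank (dualMatroid L) B + rank (dualMatroid Q) A ≤ rank (dualMatroid L) A + rank (dualMatroid Q) B
  increment-≤-dual A B A⊆B =
    ∸+∸-mono-≤ (rank-⊤≤∣X∣+rank-∁X L B) (rank-⊤≤∣X∣+rank-∁X Q A)
               (rank-⊤≤∣X∣+rank-∁X L A) (rank-⊤≤∣X∣+rank-∁X Q B) (begin
      (∣B∣ + l (∁ B)) + (∣A∣ + q (∁ A))   ≡⟨ shuffle ∣B∣ (l (∁ B)) ∣A∣ (q (∁ A)) ⟩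
      (∣A∣ + ∣B∣) + (q (∁ A) + l (∁ B))
        ≤⟨ +-monoʳ-≤ (∣A∣ + ∣B∣) (increment-≤ Q≼L (∁ B) (∁ A) (p⊆q⇒∁p⊇∁q A⊆B)) ⟩
      (∣A∣ + ∣B∣) + (q (∁ B) + l (∁ A))   ≡⟨ shuffle′ ∣A∣ ∣B∣ (q (∁ B)) (l (∁ A)) ⟩
      (∣A∣ + l (∁ A)) + (∣B∣ + q (∁ B))   ∎)
    where
    open ≤-Reasoning
    ∣A∣ ∣B∣ : ℕ
    ∣A∣ = ∣ A ∣
    ∣B∣ = ∣ B ∣
    shuffle : ∀ a b c d → (a + b) + (c + d) ≡ (c + a) + (d + b)
    shuffle = solve-∀
    shuffle′ : ∀ a b c d → (a + b) + (c + d) ≡ (a + d) + (b + c)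
    shuffle′ = solve-∀

liftGap-dual : {Q L : Matroid n} → Q ≼ L → liftGap (dualMatroid L) (dualMatroid Q) ≡ liftGap Q L
liftGap-dual {n} {Q} {L} Q≼L = begin
  rank (dualMatroid Q) ⊤ ∸ rank (dualMatroid L) ⊤    ≡⟨ cong₂ _∸_ (rank-dual-⊤ Q) (rank-dual-⊤ L) ⟩
  (n ∸ rank Q ⊤) ∸ (n ∸ rank L ⊤)                    ≡⟨ cong (_∸ (n ∸ rank L ⊤)) split ⟨
  ((n ∸ rank L ⊤) + liftGap Q L) ∸ (n ∸ rank L ⊤)    ≡⟨ m+n∸m≡n (n ∸ rank L ⊤) (liftGap Q L) ⟩
  liftGap Q L                                        ∎
  where
  open ≡-Reasoning
  split : (n ∸ rank L ⊤) + (rank L ⊤ ∸ rank Q ⊤) ≡ n ∸ rank Q ⊤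
  split = ∸+∸≡∸ (≼⇒rank-≤ Q≼L ⊤) (rank-⊤-≤-n L)

IsBasisOf-dual⁺ : (M : Matroid n) {B : Subset n} →
                  IsBasisOf (rank M) B → IsBasisOf (rank (dualMatroid M)) (∁ B)
IsBasisOf-dual⁺ {n} M {B} (rB≡∣B∣ , rB≡r⊤) =
  r*∁B≡∣∁B∣ , trans r*∁B≡∣∁B∣ (trans ∣∁B∣≡n∸r⊤ (sym (rank-dual-⊤ M)))
  where
  open ≡-Reasoning
  r*∁B≡∣∁B∣ : rank (dualMatroid M) (∁ B) ≡ ∣ ∁ B ∣
  r*∁B≡∣∁B∣ = begin
    (∣ ∁ B ∣ + rank M (∁ (∁ B))) ∸ rank M ⊤   ≡⟨ cong (λ X → (∣ ∁ B ∣ + rank M X) ∸ rank M ⊤) (∁-involutive B) ⟩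
    (∣ ∁ B ∣ + rank M B) ∸ rank M ⊤           ≡⟨ cong (λ r → (∣ ∁ B ∣ + r) ∸ rank M ⊤) rB≡r⊤ ⟩
    (∣ ∁ B ∣ + rank M ⊤) ∸ rank M ⊤           ≡⟨ m+n∸n≡m (∣ ∁ B ∣) (rank M ⊤) ⟩
    ∣ ∁ B ∣                                   ∎
  ∣∁B∣≡n∸r⊤ : ∣ ∁ B ∣ ≡ n ∸ rank M ⊤
  ∣∁B∣≡n∸r⊤ = trans (∣∁p∣≡n∸∣p∣ B) (cong (n ∸_) (trans (sym rB≡∣B∣) rB≡r⊤))

IsBasisOf-dual⁻ : (M : Matroid n) {G : Subset n} →
                  IsBasisOf (rank (dualMatroid M)) G → IsBasisOf (rank M) (∁ G)
IsBasisOf-dual⁻ {n} M {G} (r*G≡∣G∣ , r*G≡r*⊤) = trans r∁G≡r⊤ (sym ∣∁G∣≡r⊤) , r∁G≡r⊤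
  where
  open ≡-Reasoning
  r∁G≡r⊤ : rank M (∁ G) ≡ rank M ⊤
  r∁G≡r⊤ = +-cancelˡ-≡ ∣ G ∣ _ _ (begin
    ∣ G ∣ + rank M (∁ G)                                  ≡⟨ m∸n+n≡m (rank-⊤≤∣X∣+rank-∁X M G) ⟨
    ((∣ G ∣ + rank M (∁ G)) ∸ rank M ⊤) + rank M ⊤        ≡⟨ cong (_+ rank M ⊤) r*G≡∣G∣ ⟩
    ∣ G ∣ + rank M ⊤                                      ∎)
  ∣∁G∣≡r⊤ : ∣ ∁ G ∣ ≡ rank M ⊤
  ∣∁G∣≡r⊤ = begin
    ∣ ∁ G ∣                   ≡⟨ ∣∁p∣≡n∸∣p∣ G ⟩
    n ∸ ∣ G ∣                 ≡⟨ cong (n ∸_) (trans (sym r*G≡∣G∣) (trans r*G≡r*⊤ (rank-dual-⊤ M))) ⟩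
    n ∸ (n ∸ rank M ⊤)        ≡⟨ m∸[m∸n]≡n (rank-⊤-≤-n M) ⟩
    rank M ⊤                  ∎

higgsLift-dual : {Q L : Matroid n} (Q≼L : Q ≼ L) {i : ℕ} → i ≤ liftGap Q L → ∀ X →
  rank (dualMatroid (higgsLift Q≼L i)) X ≡ higgsRank (dualMatroid L) (dualMatroid Q) (liftGap Q L ∸ i) X
higgsLift-dual {Q = Q} {L} Q≼L {i} i≤k X = begin
  (∣ X ∣ + (q (∁ X) + i) ⊓ l (∁ X)) ∸ (q ⊤ + i) ⊓ l ⊤
    ≡⟨ cong₂ _∸_ (+-distribˡ-⊓ ∣ X ∣ (q (∁ X) + i) (l (∁ X))) (higgsRank-⊤ Q≼L i≤k) ⟩
  ((∣ X ∣ + (q (∁ X) + i)) ⊓ SL) ∸ (q ⊤ + i)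
    ≡⟨ ∸-distribʳ-⊓ (q ⊤ + i) (∣ X ∣ + (q (∁ X) + i)) SL ⟩
  ((∣ X ∣ + (q (∁ X) + i)) ∸ (q ⊤ + i)) ⊓ (SL ∸ (q ⊤ + i))
    ≡⟨ cong (_⊓ (SL ∸ (q ⊤ + i))) cancel-i ⟩
  (SQ ∸ q ⊤) ⊓ (SL ∸ (q ⊤ + i))
    ≡⟨ ⊓-comm (SQ ∸ q ⊤) (SL ∸ (q ⊤ + i)) ⟩
  (SL ∸ (q ⊤ + i)) ⊓ (SQ ∸ q ⊤)
    ≡⟨ cong (_⊓ (SQ ∸ q ⊤)) split ⟨
  ((SL ∸ l ⊤) + (liftGap Q L ∸ i)) ⊓ (SQ ∸ q ⊤)
    ∎
  where
  open ≡-Reasoning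
  q l : Subset _ → ℕ
  q = rank Q
  l = rank L
  SQ SL : ℕ
  SQ = ∣ X ∣ + q (∁ X)
  SL = ∣ X ∣ + l (∁ X)
  cancel-i : (∣ X ∣ + (q (∁ X) + i)) ∸ (q ⊤ + i) ≡ SQ ∸ q ⊤
  cancel-i = trans (cong₂ _∸_ (sym (+-assoc ∣ X ∣ (q (∁ X)) i)) (+-comm (q ⊤) i))
                   ([m+n]∸[m+o]≡n∸o′ SQ (q ⊤) i)
    where
    [m+n]∸[m+o]≡n∸o′ : ∀ a b c → (a + c) ∸ (c + b) ≡ a ∸ b
    [m+n]∸[m+o]≡n∸o′ a b c = trans (cong (_∸ (c + b)) (+-comm a c)) ([m+n]∸[m+o]≡n∸o c a b)
  split : (SL ∸ l ⊤) + (liftGap Q L ∸ i) ≡ SL ∸ (q ⊤ + i)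
  split = begin
    (SL ∸ l ⊤) + ((l ⊤ ∸ q ⊤) ∸ i)    ≡⟨ cong ((SL ∸ l ⊤) +_) (∸-+-assoc (l ⊤) (q ⊤) i) ⟩
    (SL ∸ l ⊤) + (l ⊤ ∸ (q ⊤ + i))    ≡⟨ ∸+∸≡∸ (liftGap≤⇒+≤ Q≼L i≤k) (rank-⊤≤∣X∣+rank-∁X L X) ⟩
    SL ∸ (q ⊤ + i)                    ∎

-- Deletion

deletion : Matroid (suc n) → Fin (suc n) → Matroid n
deletion M e = record
  { rank      = λ X → rank M (insertAt X e outside)
  ; rank-≤    = λ X → subst (rank M (insertAt X e outside) ≤_) (∣insertAt-outside∣ X e) (rank-≤ M _)
  ; rank-mono = λ X Y X⊆Y → rank-mono M _ _ (insertAt-⊆ e X⊆Y)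
  ; rank-sub  = λ X Y →
      subst₂ (λ U I → rank M U + rank M I ≤ rank M (insertAt X e outside) + rank M (insertAt Y e outside))
             (insertAt-∪ X Y e) (insertAt-∩ X Y e) (rank-sub M _ _)
  }

≼-deletion : {Q L : Matroid (suc n)} → Q ≼ L → (e : Fin (suc n)) → deletion Q e ≼ deletion L e
≼-deletion Q≼L e = ≼-intro λ A B A⊆B → increment-≤ Q≼L _ _ (insertAt-⊆ e A⊆B)

rank-⊤≤1+rank-deletion-⊤ : (M : Matroid (suc n)) (e : Fin (suc n)) →
                           rank M ⊤ ≤ suc (rank (deletion M e) ⊤)
rank-⊤≤1+rank-deletion-⊤ M e = begin
  rank M ⊤                                     ≡⟨ cong (rank M) (insertAt-⊤∪⁅e⁆ e) ⟨
  rank M (insertAt ⊤ e outside ∪ ⁅ e ⁆)        ≤⟨ rank-∪-≤ M _ ⁅ e ⁆ ⟩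
  rank (deletion M e) ⊤ + rank M ⁅ e ⁆         ≤⟨ +-monoʳ-≤ (rank (deletion M e) ⊤) rank⁅e⁆≤1 ⟩
  rank (deletion M e) ⊤ + 1                    ≡⟨ +-comm _ 1 ⟩
  suc (rank (deletion M e) ⊤)                  ∎
  where
  open ≤-Reasoning
  rank⁅e⁆≤1 : rank M ⁅ e ⁆ ≤ 1
  rank⁅e⁆≤1 = subst (rank M ⁅ e ⁆ ≤_) (∣⁅x⁆∣≡1 e) (rank-≤ M ⁅ e ⁆)

module _ (M : Matroid (suc n)) (e : Fin (suc n)) {G : Subset n} where

  IsBasisOf-deletion⁺ : IsBasisOf (rank M) (insertAt G e outside) →
                        IsBasisOf (rank (deletion M e)) G × rank (deletion M e) ⊤ ≡ rank M ⊤
  IsBasisOf-deletion⁺ (rG≡∣G∣ , rG≡r⊤) =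
    (trans rG≡∣G∣ (∣insertAt-outside∣ G e) , trans rG≡r⊤ (sym rE-e≡rE)) , rE-e≡rE
    where
    rE-e≡rE : rank (deletion M e) ⊤ ≡ rank M ⊤
    rE-e≡rE = ≤-antisym (rank-≤-rank-⊤ M _)
                        (subst (_≤ rank (deletion M e) ⊤) rG≡r⊤ (rank-mono (deletion M e) G ⊤ ⊆⊤))

  IsBasisOf-deletion⁻ : IsBasisOf (rank (deletion M e)) G → rank (deletion M e) ⊤ ≡ rank M ⊤ →
                        IsBasisOf (rank M) (insertAt G e outside)
  IsBasisOf-deletion⁻ (rG≡∣G∣ , rG≡rE-e) rE-e≡rE =
    trans rG≡∣G∣ (sym (∣insertAt-outside∣ G e)) , trans rG≡rE-e rE-e≡rE

-- Quotients as minors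

take-++ : (Y : Subset n) (Z : Subset m) → take n (Y ++ Z) ≡ Y
take-++ {n} Y Z = ++-injectiveˡ (take n (Y ++ Z)) Y (take++drop≡id n (Y ++ Z))

drop-++ : (Y : Subset n) (Z : Subset m) → drop n (Y ++ Z) ≡ Z
drop-++ {n} Y Z = ++-injectiveʳ (take n (Y ++ Z)) Y (take++drop≡id n (Y ++ Z))

∣++∣ : (Y : Subset n) (Z : Subset m) → ∣ Y ++ Z ∣ ≡ ∣ Y ∣ + ∣ Z ∣
∣++∣ [] Z = refl
∣++∣ (inside ∷ Y) Z = cong suc (∣++∣ Y Z)
∣++∣ (outside ∷ Y) Z = ∣++∣ Y Z

∣take∣+∣drop∣ : (A : Subset (n + m)) → ∣ take n A ∣ + ∣ drop n A ∣ ≡ ∣ A ∣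
∣take∣+∣drop∣ {n} A = trans (sym (∣++∣ (take n A) (drop n A))) (cong ∣_∣ (take++drop≡id n A))

take-⊆ : {A B : Subset (n + m)} → A ⊆ B → take n A ⊆ take n B
take-⊆ {n} {A = A} {B} A⊆B =
  p∩q≡p⇒p⊆q (trans (sym (take-zipWith _∧_ A B)) (cong (take n) (p⊆q⇒p∩q≡p A⊆B)))

drop-⊆ : {A B : Subset (n + m)} → A ⊆ B → drop n A ⊆ drop n B
drop-⊆ {n} {A = A} {B} A⊆B =
  p∩q≡p⇒p⊆q (trans (sym (drop-zipWith _∧_ A B)) (cong (drop n) (p⊆q⇒p∩q≡p A⊆B)))

_⊕_ : Matroid n → Matroid m → Matroid (n + m)
_⊕_ {n} M N = record
  { rank      = r
  ; rank-≤    = λ A → ≤-trans (+-mono-≤ (rank-≤ M _) (rank-≤ N _)) (≤-reflexive (∣take∣+∣drop∣ {n} A))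
  ; rank-mono = λ A B A⊆B → +-mono-≤ (rank-mono M _ _ (take-⊆ A⊆B)) (rank-mono N _ _ (drop-⊆ {n} A⊆B))
  ; rank-sub  = r-sub
  }
  where
  r : Subset (n + _) → ℕ
  r A = rank M (take n A) + rank N (drop n A)
  r-sub : ∀ A B → r (A ∪ B) + r (A ∩ B) ≤ r A + r B
  r-sub A B = begin
    r (A ∪ B) + r (A ∩ B)
      ≡⟨ cong₂ _+_ (split-zipWith _∨_) (split-zipWith _∧_) ⟩
    (rank M (tA ∪ tB) + rank N (dA ∪ dB)) + (rank M (tA ∩ tB) + rank N (dA ∩ dB))
      ≡⟨ interchange (rank M (tA ∪ tB)) (rank N (dA ∪ dB)) (rank M (tA ∩ tB)) (rank N (dA ∩ dB)) ⟩
    (rank M (tA ∪ tB) + rank M (tA ∩ tB)) + (rank N (dA ∪ dB) + rank N (dA ∩ dB))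
      ≤⟨ +-mono-≤ (rank-sub M tA tB) (rank-sub N dA dB) ⟩
    (rank M tA + rank M tB) + (rank N dA + rank N dB)
      ≡⟨ interchange (rank M tA) (rank M tB) (rank N dA) (rank N dB) ⟩
    r A + r B ∎
    where
    open ≤-Reasoning
    tA tB : Subset n
    tA = take n A
    tB = take n B
    dA dB : Subset _
    dA = drop n A
    dB = drop n B
    split-zipWith : (f : Bool → Bool → Bool) →
                    r (zipWith f A B) ≡ rank M (zipWith f tA tB) + rank N (zipWith f dA dB)
    split-zipWith f =
      cong₂ _+_ (cong (rank M) (take-zipWith f A B)) (cong (rank N) (drop-zipWith {m = n} f A B))

rank-⊕-++ : (M : Matroid n) (N : Matroid m) (Y : Subset n) (Z : Subset m) →
            rank (M ⊕ N) (Y ++ Z) ≡ rank M Y + rank N Z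
rank-⊕-++ M N Y Z = cong₂ (λ A B → rank M A + rank N B) (take-++ Y Z) (drop-++ Y Z)

≼-⊕ : {Q L : Matroid n} {Q′ L′ : Matroid m} → Q ≼ L → Q′ ≼ L′ → (Q ⊕ Q′) ≼ (L ⊕ L′)
≼-⊕ {n} {Q = Q} {L} {Q′} {L′} Q≼L Q′≼L′ = ≼-intro λ A B A⊆B →
  subst₂ _≤_ (interchange (rank Q (take n B)) (rank L (take n A)) (rank Q′ (drop n B)) (rank L′ (drop n A)))
             (interchange (rank Q (take n A)) (rank L (take n B)) (rank Q′ (drop n A)) (rank L′ (drop n B)))
    (+-mono-≤ (increment-≤ Q≼L _ _ (take-⊆ A⊆B)) (increment-≤ Q′≼L′ _ _ (drop-⊆ {n} A⊆B)))

loops : ∀ m → Matroid m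
loops m = record
  { rank = λ _ → 0 ; rank-≤ = λ _ → z≤n ; rank-mono = λ _ _ _ → z≤n ; rank-sub = λ _ _ → z≤n }

free : ∀ m → Matroid m
free m = record
  { rank      = ∣_∣
  ; rank-≤    = λ _ → ≤-refl
  ; rank-mono = λ _ _ → p⊆q⇒∣p∣≤∣q∣
  ; rank-sub  = λ X Y → ≤-reflexive (∣p∪q∣+∣p∩q∣≡∣p∣+∣q∣ X Y)
  }

loops≼free : ∀ m → loops m ≼ free m
loops≼free m = ≼-intro λ _ _ → p⊆q⇒∣p∣≤∣q∣

isQuotient⇒≼ : {Q L : Matroid n} → IsQuotient Q L → Q ≼ L
isQuotient⇒≼ {n} {Q} {L} (m , M , L≡M∖X , Q≡M/X) = ≼-intro λ A B A⊆B →
  subst₂ _≤_ (cong₂ _+_ (sym (Q≡M/X B)) (sym (L≡M∖X A))) (cong₂ _+_ (sym (Q≡M/X A)) (sym (L≡M∖X B)))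
    (∸+∸-mono-≤ (X⊆-rank-≤ B) z≤n (X⊆-rank-≤ A) z≤n (submodular-across A B A⊆B))
  where
  rX : ℕ
  rX = rank M (⊥ {n} ++ ⊤ {m})
  X⊆-rank-≤ : ∀ Y → rX ≤ rank M (Y ++ ⊤)
  X⊆-rank-≤ Y =
    rank-mono M _ _ (p∩q≡p⇒p⊆q (trans (zipWith-++ _∧_ ⊥ ⊤ Y ⊤) (cong₂ _++_ (∩-zeroˡ Y) (∩-idem ⊤))))
  submodular-across : ∀ A B → A ⊆ B →
                      rank M (B ++ ⊤) + rank M (A ++ ⊥) ≤ rank M (A ++ ⊤) + rank M (B ++ ⊥)
  submodular-across A B A⊆B =
    subst₂ (λ U I → rank M U + rank M I ≤ rank M (A ++ ⊤) + rank M (B ++ ⊥))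
      (trans (zipWith-++ _∨_ A ⊤ B ⊥) (cong₂ _++_ (p⊆q⇒p∪q≡q A⊆B) (∪-zeroˡ ⊥)))
      (trans (zipWith-++ _∧_ A ⊤ B ⊥) (cong₂ _++_ (p⊆q⇒p∩q≡p A⊆B) (∩-identityˡ ⊥)))
      (rank-sub M (A ++ ⊤) (B ++ ⊥))

rank-≤-rank+liftGap : {Q L : Matroid n} → Q ≼ L → ∀ Y → rank L Y ≤ rank Q Y + liftGap Q L
rank-≤-rank+liftGap {Q = Q} {L} Q≼L Y = +-cancelˡ-≤ (rank Q ⊤) _ _ (begin
  rank Q ⊤ + rank L Y                  ≤⟨ increment-≤ Q≼L Y ⊤ ⊆⊤ ⟩
  rank Q Y + rank L ⊤                  ≡⟨ cong (rank Q Y +_) (m+[n∸m]≡n (≼⇒rank-≤ Q≼L ⊤)) ⟨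
  rank Q Y + (rank Q ⊤ + liftGap Q L)  ≡⟨ x+[y+z]≡y+[x+z] (rank Q Y) (rank Q ⊤) (liftGap Q L) ⟩
  rank Q ⊤ + (rank Q Y + liftGap Q L)  ∎)
  where
  open ≤-Reasoning
  x+[y+z]≡y+[x+z] : ∀ x y z → x + (y + z) ≡ y + (x + z)
  x+[y+z]≡y+[x+z] = solve-∀

-- The witness is a Higgs lift of (Q ⊕ loops) towards (L ⊕ free) on E ⊔ X with |X| = r(L) - r(Q).
≼⇒isQuotient : {Q L : Matroid n} → Q ≼ L → IsQuotient Q L
≼⇒isQuotient {n} {Q} {L} Q≼L = k , M , L≡M∖X , Q≡M/X
  where
  open ≡-Reasoning
  k : ℕ
  k = liftGap Q L
  M : Matroid (n + k)
  M = higgsLift (≼-⊕ Q≼L (loops≼free k)) k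
  rank-M : ∀ Y Z → rank M (Y ++ Z) ≡ (rank Q Y + k) ⊓ (rank L Y + ∣ Z ∣)
  rank-M Y Z = cong₂ (λ a b → (a + k) ⊓ b)
    (trans (rank-⊕-++ Q (loops k) Y Z) (+-identityʳ (rank Q Y))) (rank-⊕-++ L (free k) Y Z)
  rank-M-++⊤ : ∀ Y → rank M (Y ++ ⊤) ≡ rank Q Y + k
  rank-M-++⊤ Y = begin
    rank M (Y ++ ⊤)                            ≡⟨ rank-M Y (⊤ {k}) ⟩
    (rank Q Y + k) ⊓ (rank L Y + ∣ ⊤ {k} ∣)    ≡⟨ cong (λ z → (rank Q Y + k) ⊓ (rank L Y + z)) (∣⊤∣≡n k) ⟩
    (rank Q Y + k) ⊓ (rank L Y + k)            ≡⟨ m≤n⇒m⊓n≡m (+-monoˡ-≤ k (≼⇒rank-≤ Q≼L Y)) ⟩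
    rank Q Y + k                               ∎
  L≡M∖X : ∀ Y → rank L Y ≡ rank M (Y ++ ⊥)
  L≡M∖X Y = sym (begin
    rank M (Y ++ ⊥)                            ≡⟨ rank-M Y (⊥ {k}) ⟩
    (rank Q Y + k) ⊓ (rank L Y + ∣ ⊥ {k} ∣)    ≡⟨ cong (λ z → (rank Q Y + k) ⊓ (rank L Y + z)) (∣⊥∣≡0 k) ⟩
    (rank Q Y + k) ⊓ (rank L Y + 0)            ≡⟨ cong ((rank Q Y + k) ⊓_) (+-identityʳ (rank L Y)) ⟩
    (rank Q Y + k) ⊓ rank L Y                  ≡⟨ m≥n⇒m⊓n≡n (rank-≤-rank+liftGap Q≼L Y) ⟩
    rank L Y                                   ∎)
  Q≡M/X : ∀ Y → rank Q Y ≡ rank M (Y ++ ⊤) ∸ rank M (⊥ {n} ++ ⊤)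
  Q≡M/X Y = sym (begin
    rank M (Y ++ ⊤) ∸ rank M (⊥ {n} ++ ⊤)      ≡⟨ cong₂ _∸_ (rank-M-++⊤ Y) (rank-M-++⊤ ⊥) ⟩
    (rank Q Y + k) ∸ (rank Q ⊥ + k)            ≡⟨ cong (λ z → (rank Q Y + k) ∸ (z + k)) (rank-⊥ Q) ⟩
    (rank Q Y + k) ∸ k                         ≡⟨ m+n∸n≡m (rank Q Y) k ⟩
    rank Q Y                                   ∎)

-- Index sets

_↾_ : (ℕ → Bool) → ℕ → ℕ → Bool
(K ↾ c) i = K i ∧ (i ≤ᵇ c)

reflect : ℕ → (ℕ → Bool) → ℕ → Bool
reflect k K j = (j ≤ᵇ k) ∧ K (k ∸ j)

≤ᵇ-true⁺ : ∀ {i j} → i ≤ j → (i ≤ᵇ j) ≡ true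
≤ᵇ-true⁺ i≤j = Equivalence.to T-≡ (≤⇒≤ᵇ i≤j)

≤ᵇ-true⁻ : ∀ {i j} → (i ≤ᵇ j) ≡ true → i ≤ j
≤ᵇ-true⁻ {i} {j} eq = ≤ᵇ⇒≤ i j (Equivalence.from T-≡ eq)

∧-true⁻ : ∀ {a b} → a ∧ b ≡ true → a ≡ true × b ≡ true
∧-true⁻ {a} {b} eq = ∧-conicalˡ a b eq , ∧-conicalʳ a b eq

∧-true⁺ : ∀ {a b} → a ≡ true → b ≡ true → a ∧ b ≡ true
∧-true⁺ refl refl = refl

↾-true⁻ : ∀ K {c i} → (K ↾ c) i ≡ true → K i ≡ true × i ≤ c
↾-true⁻ K {c} {i} eq = map₂ ≤ᵇ-true⁻ (∧-true⁻ {K i} eq)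

↾-true⁺ : ∀ K {c i} → K i ≡ true → i ≤ c → (K ↾ c) i ≡ true
↾-true⁺ K Ki i≤c = ∧-true⁺ Ki (≤ᵇ-true⁺ i≤c)

KCondition-bounded : ∀ kind {k K} → KCondition kind k K → ∀ {i} → K i ≡ true → i ≤ k
KCondition-bounded general (bounded , _) = bounded _
KCondition-bounded full admissible = proj₁ (admissible _)
KCondition-bounded even ((bounded , _) , _) = bounded _

KCondition-↾-general : ∀ {k K c} → KCondition general k K → c ≤ k → KCondition general c (K ↾ c)
KCondition-↾-general {K = K} (_ , no-gap) c≤k =
  (λ i Kci → proj₂ (↾-true⁻ K Kci)) ,
  λ i 1+i≤c → map-⊎ (λ Ki → ↾-true⁺ K Ki (<⇒≤ 1+i≤c)) (λ K1+i → ↾-true⁺ K K1+i 1+i≤c)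
                    (no-gap i (≤-trans 1+i≤c c≤k))

KCondition-↾-full : ∀ {k K c} → KCondition full k K → c ≤ k → KCondition full c (K ↾ c)
KCondition-↾-full {K = K} full-K c≤k i =
  (λ Kci → proj₂ (↾-true⁻ K Kci)) , λ i≤c → ↾-true⁺ K (proj₂ (full-K i) (≤-trans i≤c c≤k)) i≤c

KCondition-↾-even : ∀ {k K c} → KCondition even k K → c ≤ k → Even c → KCondition even c (K ↾ c)
KCondition-↾-even {K = K} (general-K , _ , even-K) c≤k even-c =
  KCondition-↾-general general-K c≤k , even-c , λ i Kci → even-K i (proj₁ (↾-true⁻ K Kci))

record Truncation (kind : Kind) (k′ : ℕ) (K : ℕ → Bool) : Set where
  field
    bound            : ℕ
    bound≤           : bound ≤ k′
    bound-admissible : KCondition kind bound (K ↾ bound)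
    bound-keeps      : ∀ {i} → K i ≡ true → i ≤ k′ → i ≤ bound

-- In the even case k′ may be odd, k′ = k - 1; the bound is then k′ - 1, which loses no even index.
truncation : ∀ kind {k k′ K} → KCondition kind k K → k′ ≤ k → k ≤ suc k′ → Truncation kind k′ K
truncation general {k′ = k′} admissible k′≤k _ =
  record { bound = k′ ; bound≤ = ≤-refl ; bound-admissible = KCondition-↾-general admissible k′≤k
         ; bound-keeps = λ _ i≤k′ → i≤k′ }
truncation full {k′ = k′} admissible k′≤k _ =
  record { bound = k′ ; bound≤ = ≤-refl ; bound-admissible = KCondition-↾-full admissible k′≤k
         ; bound-keeps = λ _ i≤k′ → i≤k′ }
truncation even {k′ = k′} {K} admissible@(_ , even-k , even-K) k′≤k k≤1+k′ with m≤n⇒m<n∨m≡n k′≤k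
... | inj₂ refl =
  record { bound = k′ ; bound≤ = ≤-refl ; bound-admissible = KCondition-↾-even admissible k′≤k even-k
         ; bound-keeps = λ _ i≤k′ → i≤k′ }
... | inj₁ k′<k with even-pred (subst Even (≤-antisym k≤1+k′ k′<k) even-k)
...   | t , refl =
  record { bound = t + t ; bound≤ = n≤1+n (t + t)
         ; bound-admissible = KCondition-↾-even admissible (≤-trans (n≤1+n (t + t)) k′≤k) (t , refl)
         ; bound-keeps = keep }
  where
  keep : ∀ {i} → K i ≡ true → i ≤ suc (t + t) → i ≤ t + t
  keep {i} Ki i≤k′ with even-K i Ki
  ... | s , refl = even-≤-odd s t i≤k′

KCondition-reflect : ∀ kind {k K} → KCondition kind k K → KCondition kind k (reflect k K)
KCondition-reflect general {k} {K} (_ , no-gap) = (λ j eq → ≤ᵇ-true⁻ (proj₁ (∧-true⁻ eq))) , no-gap′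
  where
  1+[k∸1+j]≡k∸j : ∀ {j} → suc j ≤ k → suc (k ∸ suc j) ≡ k ∸ j
  1+[k∸1+j]≡k∸j 1+j≤k = sym (+-∸-assoc 1 1+j≤k)
  no-gap′ : ∀ j → suc j ≤ k → reflect k K j ≡ true ⊎ reflect k K (suc j) ≡ true
  no-gap′ j 1+j≤k with no-gap (k ∸ suc j) (subst (_≤ k) (sym (1+[k∸1+j]≡k∸j 1+j≤k)) (m∸n≤m k j))
  ... | inj₁ K[k∸1+j] = inj₂ (∧-true⁺ (≤ᵇ-true⁺ 1+j≤k) K[k∸1+j])
  ... | inj₂ K[1+k∸1+j] =
    inj₁ (∧-true⁺ (≤ᵇ-true⁺ (<⇒≤ 1+j≤k)) (subst (λ i → K i ≡ true) (1+[k∸1+j]≡k∸j 1+j≤k) K[1+k∸1+j]))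
KCondition-reflect full {k} {K} full-K j =
  (λ eq → ≤ᵇ-true⁻ (proj₁ (∧-true⁻ eq))) ,
  λ j≤k → ∧-true⁺ (≤ᵇ-true⁺ j≤k) (proj₂ (full-K (k ∸ j)) (m∸n≤m k j))
KCondition-reflect even {k} {K} (general-K , even-k , even-K) =
  KCondition-reflect general general-K , even-k , even-reflected
  where
  even-reflected : ∀ j → reflect k K j ≡ true → Even j
  even-reflected j eq with ∧-true⁻ {j ≤ᵇ k} eq
  ... | j≤ᵇk , K[k∸j] =
    subst Even (m∸[m∸n]≡n (≤ᵇ-true⁻ j≤ᵇk)) (even-∸ even-k (even-K (k ∸ j) K[k∸j]) (m∸n≤m k j))

IsDeltaMatroid-transport : {𝓕 𝓖 : Family n} → (∀ F → 𝓕 F → 𝓖 F) → (∀ F → 𝓖 F → 𝓕 F) →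
                           IsDeltaMatroid 𝓕 → IsDeltaMatroid 𝓖
IsDeltaMatroid-transport 𝓕⊆𝓖 𝓖⊆𝓕 ((F , 𝓕F) , exchange) =
  (F , 𝓕⊆𝓖 F 𝓕F) , λ X Y 𝓖X 𝓖Y u u∈X△Y →
    let v , v∈X△Y , 𝓕X△uv = exchange X Y (𝓖⊆𝓕 X 𝓖X) (𝓖⊆𝓕 Y 𝓖Y) u u∈X△Y in v , v∈X△Y , 𝓕⊆𝓖 _ 𝓕X△uv

IsDeltaMatroid-dual : {𝓕 : Family n} → IsDeltaMatroid 𝓕 → IsDeltaMatroid (dual 𝓕)
IsDeltaMatroid-dual {𝓕 = 𝓕} ((F , 𝓕F) , exchange) = (∁ F , F , 𝓕F , refl) , exchange*
  where
  exchange* : ∀ X Y → dual 𝓕 X → dual 𝓕 Y → ∀ u → u ∈ X △ Y →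
              ∃[ v ] (v ∈ X △ Y × dual 𝓕 (X △ (⁅ u ⁆ ∪ ⁅ v ⁆)))
  exchange* _ _ (F , 𝓕F , refl) (F′ , 𝓕F′ , refl) u u∈
    with exchange F F′ 𝓕F 𝓕F′ u (subst (u ∈_) (∁p△∁q≡p△q F F′) u∈)
  ... | v , v∈ , 𝓕F△uv =
    v , subst (v ∈_) (sym (∁p△∁q≡p△q F F′)) v∈ , F △ (⁅ u ⁆ ∪ ⁅ v ⁆) , 𝓕F△uv , ∁p△q≡∁[p△q] F _

IsDeltaMatroid-delete : {𝓕 : Family (suc n)} {e : Fin (suc n)} → IsDeltaMatroid 𝓕 →
                        ∀ {F} → 𝓕 F → e ∉ F → IsDeltaMatroid (deleteFam 𝓕 e)
IsDeltaMatroid-delete {n} {𝓕} {e} (_ , exchange) {F} 𝓕F e∉F =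
  (removeAt F e , subst 𝓕 (sym (insertAt-removeAt-outside e e∉F)) 𝓕F) , exchange∖e
  where
  ι : Subset n → Subset (suc n)
  ι G = insertAt G e outside
  exchange∖e : ∀ X Y → 𝓕 (ι X) → 𝓕 (ι Y) → ∀ u → u ∈ X △ Y →
               ∃[ v ] (v ∈ X △ Y × 𝓕 (ι (X △ (⁅ u ⁆ ∪ ⁅ v ⁆))))
  exchange∖e X Y 𝓕ιX 𝓕ιY u u∈X△Y
    with exchange (ι X) (ι Y) 𝓕ιX 𝓕ιY (punchIn e u)
                  (subst (punchIn e u ∈_) (sym (insertAt-△ X Y e)) (punchIn-∈-insertAt⁺ e outside u∈X△Y))
  ... | v , v∈ , 𝓕ιX△uv with e ≟ᶠ v
  ...   | yes refl = ⊥-elim (e∉insertAt-outside (X △ Y) e (subst (e ∈_) (insertAt-△ X Y e) v∈))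
  ...   | no e≢v = v′ , v′∈X△Y , subst 𝓕 ι-commutes 𝓕ιX△uv
    where
    v′ : Fin n
    v′ = punchOut e≢v
    punchIn-v′ : punchIn e v′ ≡ v
    punchIn-v′ = punchIn-punchOut e≢v
    v′∈X△Y : v′ ∈ X △ Y
    v′∈X△Y = punchIn-∈-insertAt⁻ e outside
               (subst (_∈ ι (X △ Y)) (sym punchIn-v′) (subst (v ∈_) (insertAt-△ X Y e) v∈))
    ι-commutes : ι X △ (⁅ punchIn e u ⁆ ∪ ⁅ v ⁆) ≡ ι (X △ (⁅ u ⁆ ∪ ⁅ v′ ⁆))
    ι-commutes = begin
      ι X △ (⁅ punchIn e u ⁆ ∪ ⁅ v ⁆)
        ≡⟨ cong (λ w → ι X △ (⁅ punchIn e u ⁆ ∪ ⁅ w ⁆)) punchIn-v′ ⟨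
      ι X △ (⁅ punchIn e u ⁆ ∪ ⁅ punchIn e v′ ⁆)
        ≡⟨ cong₂ (λ s t → ι X △ (s ∪ t)) (⁅punchIn⁆≡insertAt⁅⁆ e u) (⁅punchIn⁆≡insertAt⁅⁆ e v′) ⟩
      ι X △ (ι ⁅ u ⁆ ∪ ι ⁅ v′ ⁆)
        ≡⟨ cong (ι X △_) (insertAt-∪ ⁅ u ⁆ ⁅ v′ ⁆ e) ⟩
      ι X △ ι (⁅ u ⁆ ∪ ⁅ v′ ⁆)
        ≡⟨ insertAt-△ X (⁅ u ⁆ ∪ ⁅ v′ ⁆) e ⟩
      ι (X △ (⁅ u ⁆ ∪ ⁅ v′ ⁆))
        ∎
      where open ≡-Reasoning

member-∋ : {𝓕 : Family (suc n)} {e : Fin (suc n)} → (∀ F → Dec (𝓕 F)) → ¬ IsLoop 𝓕 e →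
           ∃[ F ] (𝓕 F × e ∈ F)
member-∋ {e = e} 𝓕? ¬loop with anySubset? (λ F → 𝓕? F ×-dec (e ∈? F))
... | yes member = member
... | no none = ⊥-elim (¬loop λ F 𝓕F e∈F → none (F , 𝓕F , e∈F))

member-∌ : {𝓕 : Family (suc n)} {e : Fin (suc n)} → (∀ F → Dec (𝓕 F)) → ¬ IsColoop 𝓕 e →
           ∃[ F ] (𝓕 F × e ∉ F)
member-∌ {e = e} 𝓕? ¬coloop with anySubset? (λ F → 𝓕? F ×-dec ¬? (e ∈? F))
... | yes member = member
... | no none = ⊥-elim (¬coloop λ F 𝓕F → decidable-stable (e ∈? F) λ e∉F → none (F , 𝓕F , e∉F))

-- Higgs lift delta-matroids

HiggsUnion : Matroid n → Matroid n → (ℕ → Bool) → Family n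
HiggsUnion Q L K F = ∃[ i ] (K i ≡ true × IsBasisOf (higgsRank Q L i) F)

HiggsUnion? : (Q L : Matroid n) {K : ℕ → Bool} {k : ℕ} → (∀ {i} → K i ≡ true → i ≤ k) →
                 ∀ F → Dec (HiggsUnion Q L K F)
HiggsUnion? Q L {K} {k} bounded F =
  map′ (λ (j , Kj , Bj) → toℕ j , Kj , Bj) below
       (any? λ (j : Fin (suc k)) → (K (toℕ j) ≟ᵇ true) ×-dec basis? (toℕ j))
  where
  basis? : ∀ i → Dec (IsBasisOf (higgsRank Q L i) F)
  basis? i = (higgsRank Q L i F ≟ ∣ F ∣) ×-dec (higgsRank Q L i F ≟ higgsRank Q L i ⊤)
  below : HiggsUnion Q L K F → ∃[ j ] (K (toℕ j) ≡ true × IsBasisOf (higgsRank Q L (toℕ j)) F)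
  below (i , Ki , Bi) =
    fromℕ< (s≤s (bounded Ki)) ,
    subst (λ z → K z ≡ true × IsBasisOf (higgsRank Q L z) F)
          (sym (toℕ-fromℕ< (s≤s (bounded Ki)))) (Ki , Bi)

IsHiggsLiftDM-member? : ∀ kind {𝓕 : Family n} → IsHiggsLiftDM kind 𝓕 → ∀ F → Dec (𝓕 F)
IsHiggsLiftDM-member? kind (_ , Q , L , _ , K , admissible , presents) F =
  map′ (proj₂ (presents F)) (proj₁ (presents F))
       (HiggsUnion? Q L (KCondition-bounded kind admissible) F)

isHiggsLiftDM : ∀ kind {𝓕 : Family n} → IsDeltaMatroid 𝓕 → {Q L : Matroid n} → Q ≼ L →
  ∀ K → KCondition kind (liftGap Q L) K →
  (∀ F → 𝓕 F → HiggsUnion Q L K F) → (∀ F → HiggsUnion Q L K F → 𝓕 F) → IsHiggsLiftDM kind 𝓕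
isHiggsLiftDM kind 𝓕-dm {Q} {L} Q≼L K admissible 𝓕⊆ ⊆𝓕 =
  𝓕-dm , Q , L , ≼⇒isQuotient Q≼L , K , admissible , λ F → 𝓕⊆ F , ⊆𝓕 F

IsHiggsLiftDM-transport : ∀ kind {𝓕 𝓖 : Family n} → (∀ F → 𝓕 F → 𝓖 F) → (∀ F → 𝓖 F → 𝓕 F) →
                          IsHiggsLiftDM kind 𝓕 → IsHiggsLiftDM kind 𝓖
IsHiggsLiftDM-transport kind 𝓕⊆𝓖 𝓖⊆𝓕 (𝓕-dm , Q , L , quotient , K , admissible , presents) =
  IsDeltaMatroid-transport 𝓕⊆𝓖 𝓖⊆𝓕 𝓕-dm , Q , L , quotient , K , admissible ,
  λ F → (λ 𝓖F → proj₁ (presents F) (𝓖⊆𝓕 F 𝓖F)) , λ F∈ → 𝓕⊆𝓖 F (proj₂ (presents F) F∈)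

IsHiggsLiftDM-dual : ∀ kind {𝓕 : Family n} → IsHiggsLiftDM kind 𝓕 → IsHiggsLiftDM kind (dual 𝓕)
IsHiggsLiftDM-dual kind {𝓕} (𝓕-dm , Q , L , quotient , K , admissible , presents) =
  isHiggsLiftDM kind (IsDeltaMatroid-dual 𝓕-dm) (≼-dual Q≼L) (reflect k K)
    (subst (λ g → KCondition kind g (reflect k K)) (sym (liftGap-dual Q≼L))
           (KCondition-reflect kind admissible))
    dual⊆ ⊆dual
  where
  Q≼L : Q ≼ L
  Q≼L = isQuotient⇒≼ quotient
  k : ℕ
  k = liftGap Q L
  L* Q* : Matroid _
  L* = dualMatroid L
  Q* = dualMatroid Q
  dual⊆ : ∀ G → dual 𝓕 G → HiggsUnion L* Q* (reflect k K) G
  dual⊆ _ (F , 𝓕F , refl) with proj₁ (presents F) 𝓕F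
  ... | i , Ki , B =
    k ∸ i , ∧-true⁺ (≤ᵇ-true⁺ (m∸n≤m k i)) (subst (λ j → K j ≡ true) (sym (m∸[m∸n]≡n i≤k)) Ki) ,
    IsBasisOf-cong (higgsLift-dual Q≼L i≤k) (IsBasisOf-dual⁺ (higgsLift Q≼L i) B)
    where
    i≤k : i ≤ k
    i≤k = KCondition-bounded kind admissible Ki
  ⊆dual : ∀ G → HiggsUnion L* Q* (reflect k K) G → dual 𝓕 G
  ⊆dual G (j , reflect-j , B) with ∧-true⁻ {j ≤ᵇ k} reflect-j
  ... | j≤ᵇk , K[k∸j] =
    ∁ G , proj₂ (presents (∁ G)) (k ∸ j , K[k∸j] , IsBasisOf-dual⁻ (higgsLift Q≼L (k ∸ j)) B*) ,
    sym (∁-involutive G)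
    where
    B* : IsBasisOf (rank (dualMatroid (higgsLift Q≼L (k ∸ j)))) G
    B* = IsBasisOf-cong (λ X → sym (higgsLift-dual Q≼L (m∸n≤m k j) X))
           (subst (λ i → IsBasisOf (higgsRank L* Q* i) G) (sym (m∸[m∸n]≡n (≤ᵇ-true⁻ j≤ᵇk))) B)

module _ {Q L : Matroid (suc n)} (Q≼L : Q ≼ L) (e : Fin (suc n)) where

  private
    Q′ L′ : Matroid n
    Q′ = deletion Q e
    L′ = deletion L e
    a b : ℕ
    a = rank Q′ ⊤
    b = rank L′ ⊤

  KeepsRank : ℕ → Set
  KeepsRank i = higgsRank Q′ L′ i ⊤ ≡ higgsRank Q L i ⊤

  -- If deleting e lowers r(Q), it lowers r(L) as well, and then every H^i loses rank.
  keepsRank⇒rank-deletion-⊤≡ : ∀ {i} → KeepsRank i → a ≡ rank Q ⊤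
  keepsRank⇒rank-deletion-⊤≡ {i} keeps with m≤n⇒m<n∨m≡n (rank-≤-rank-⊤ Q (insertAt ⊤ e outside))
  ... | inj₂ a≡A = a≡A
  ... | inj₁ a<A =
    ⊥-elim (1+n≢n (sym (trans keeps (cong₂ (λ x y → (x + i) ⊓ y) A≡1+a B≡1+b))))
    where
    A≡1+a : rank Q ⊤ ≡ suc a
    A≡1+a = ≤-antisym (rank-⊤≤1+rank-deletion-⊤ Q e) a<A
    B≡1+b : rank L ⊤ ≡ suc b
    B≡1+b = ≤-antisym (rank-⊤≤1+rank-deletion-⊤ L e) (+-cancelˡ-≤ a (suc b) (rank L ⊤) (begin
      a + suc b          ≡⟨ +-suc a b ⟩
      suc a + b          ≡⟨ cong (_+ b) A≡1+a ⟨
      rank Q ⊤ + b       ≤⟨ increment-≤ Q≼L (insertAt ⊤ e outside) ⊤ ⊆⊤ ⟩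
      a + rank L ⊤       ∎))
      where open ≤-Reasoning

  module _ (a≡A : a ≡ rank Q ⊤) where

    keepsRank⇒≤liftGap : ∀ {i} → i ≤ liftGap Q L → KeepsRank i → i ≤ liftGap Q′ L′
    keepsRank⇒≤liftGap {i} i≤k keeps with (a + i) ≤? b
    ... | yes a+i≤b = m+n≤o⇒m≤o∸n i (subst (_≤ b) (+-comm a i) a+i≤b)
    ... | no a+i≰b = ⊥-elim (<-irrefl b≡a+i (≰⇒> a+i≰b))
      where
      b≡a+i : b ≡ a + i
      b≡a+i = begin
        b                            ≡⟨ m≥n⇒m⊓n≡n (<⇒≤ (≰⇒> a+i≰b)) ⟨
        (a + i) ⊓ b                  ≡⟨ keeps ⟩
        (rank Q ⊤ + i) ⊓ rank L ⊤    ≡⟨ higgsRank-⊤ Q≼L i≤k ⟩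
        rank Q ⊤ + i                 ≡⟨ cong (_+ i) a≡A ⟨
        a + i                        ∎
        where open ≡-Reasoning

    ≤liftGap⇒keepsRank : ∀ {i} → i ≤ liftGap Q L → i ≤ liftGap Q′ L′ → KeepsRank i
    ≤liftGap⇒keepsRank {i} i≤k i≤k′ = begin
      (a + i) ⊓ b                  ≡⟨ higgsRank-⊤ (≼-deletion Q≼L e) i≤k′ ⟩
      a + i                        ≡⟨ cong (_+ i) a≡A ⟩
      rank Q ⊤ + i                 ≡⟨ higgsRank-⊤ Q≼L i≤k ⟨
      (rank Q ⊤ + i) ⊓ rank L ⊤    ∎
      where open ≡-Reasoning

    liftGap-deletion-≤ : liftGap Q′ L′ ≤ liftGap Q L
    liftGap-deletion-≤ =
      subst (λ x → b ∸ a ≤ rank L ⊤ ∸ x) a≡A (∸-monoˡ-≤ a (rank-≤-rank-⊤ L (insertAt ⊤ e outside)))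

    liftGap-≤-1+liftGap-deletion : liftGap Q L ≤ suc (liftGap Q′ L′)
    liftGap-≤-1+liftGap-deletion = begin
      rank L ⊤ ∸ rank Q ⊤    ≡⟨ cong (rank L ⊤ ∸_) a≡A ⟨
      rank L ⊤ ∸ a           ≤⟨ ∸-monoˡ-≤ a (rank-⊤≤1+rank-deletion-⊤ L e) ⟩
      suc b ∸ a              ≡⟨ +-∸-assoc 1 (≼⇒rank-≤ (≼-deletion Q≼L e) ⊤) ⟩
      suc (b ∸ a)            ∎
      where open ≤-Reasoning

IsHiggsLiftDM-delete : ∀ kind {𝓕 : Family (suc n)} {e : Fin (suc n)} → IsHiggsLiftDM kind 𝓕 →
                       ∀ {F} → 𝓕 F → e ∉ F → IsHiggsLiftDM kind (deleteFam 𝓕 e)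
IsHiggsLiftDM-delete kind {𝓕} {e} (𝓕-dm , Q , L , quotient , K , admissible , presents) {F} 𝓕F e∉F =
  isHiggsLiftDM kind (IsDeltaMatroid-delete 𝓕-dm 𝓕F e∉F) (≼-higgsLift Q′≼L′ bound) (K ↾ bound)
    (subst (λ g → KCondition kind g (K ↾ bound)) (sym (liftGap-higgsLift Q′≼L′ bound≤)) bound-admissible)
    delete⊆ ⊆delete
  where
  Q≼L : Q ≼ L
  Q≼L = isQuotient⇒≼ quotient
  Q′≼L′ : deletion Q e ≼ deletion L e
  Q′≼L′ = ≼-deletion Q≼L e
  ι : Subset _ → Subset _
  ι G = insertAt G e outside

  in-deletion : ∀ {i G} → IsBasisOf (higgsRank Q L i) (ι G) →
                IsBasisOf (higgsRank (deletion Q e) (deletion L e) i) G × KeepsRank Q≼L e i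
  in-deletion {i} = IsBasisOf-deletion⁺ (higgsLift Q≼L i) e

  a≡A : rank (deletion Q e) ⊤ ≡ rank Q ⊤
  a≡A =
    let i , _ , B = proj₁ (presents F) 𝓕F
        B∖e = subst (IsBasisOf (higgsRank Q L i)) (sym (insertAt-removeAt-outside e e∉F)) B
    in keepsRank⇒rank-deletion-⊤≡ Q≼L e (proj₂ (in-deletion B∖e))

  open Truncation
    (truncation kind admissible (liftGap-deletion-≤ Q≼L e a≡A) (liftGap-≤-1+liftGap-deletion Q≼L e a≡A))

  delete⊆ : ∀ G → deleteFam 𝓕 e G → HiggsUnion (deletion Q e) (higgsLift Q′≼L′ bound) (K ↾ bound) G
  delete⊆ G 𝓕ιG =
    let i , Ki , B = proj₁ (presents (ι G)) 𝓕ιG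
        B′ , keeps = in-deletion B
        i≤c = bound-keeps Ki (keepsRank⇒≤liftGap Q≼L e a≡A (KCondition-bounded kind admissible Ki) keeps)
    in i , ↾-true⁺ K Ki i≤c , IsBasisOf-cong (λ X → sym (higgsRank-higgsLift Q′≼L′ i≤c X)) B′

  ⊆delete : ∀ G → HiggsUnion (deletion Q e) (higgsLift Q′≼L′ bound) (K ↾ bound) G → deleteFam 𝓕 e G
  ⊆delete G (i , K↾i , B) =
    let Ki , i≤c = ↾-true⁻ K K↾i
    in proj₂ (presents (ι G)) (i , Ki , IsBasisOf-deletion⁻ (higgsLift Q≼L i) e
         (IsBasisOf-cong (higgsRank-higgsLift Q′≼L′ i≤c) B)
         (≤liftGap⇒keepsRank Q≼L e a≡A (KCondition-bounded kind admissible Ki) (≤-trans i≤c bound≤)))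

IsHiggsLiftDM-contract : ∀ kind {𝓕 : Family (suc n)} {e : Fin (suc n)} → IsHiggsLiftDM kind 𝓕 →
                         ∀ {F} → 𝓕 F → e ∈ F → IsHiggsLiftDM kind (contractFam 𝓕 e)
IsHiggsLiftDM-contract kind {𝓕} {e} hl {F} 𝓕F e∈F =
  IsHiggsLiftDM-transport kind dual-delete-dual⊆ ⊆dual-delete-dual
    (IsHiggsLiftDM-dual kind
      (IsHiggsLiftDM-delete kind (IsHiggsLiftDM-dual kind hl) (F , 𝓕F , refl) (x∈p⇒x∉∁p e∈F)))
  where
  dual-delete-dual⊆ : ∀ G → dual (deleteFam (dual 𝓕) e) G → contractFam 𝓕 e G
  dual-delete-dual⊆ _ (H , (F′ , 𝓕F′ , ιH≡∁F′) , refl) =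
    subst 𝓕 (trans (sym (∁-involutive F′)) (trans (cong ∁ (sym ιH≡∁F′)) (map-insertAt not outside H e)))
            𝓕F′
  ⊆dual-delete-dual : ∀ G → contractFam 𝓕 e G → dual (deleteFam (dual 𝓕) e) G
  ⊆dual-delete-dual G 𝓕G+e =
    ∁ G , (insertAt G e inside , 𝓕G+e , sym (map-insertAt not inside G e)) , sym (∁-involutive G)

IsHiggsLiftDM-minorStep : ∀ kind {𝓕 : Family (suc n)} {𝓖 : Family n} → MinorStep 𝓕 𝓖 →
                          IsHiggsLiftDM kind 𝓕 → IsHiggsLiftDM kind 𝓖
IsHiggsLiftDM-minorStep kind (contract e _ ¬loop) hl =
  let F , 𝓕F , e∈F = member-∋ (IsHiggsLiftDM-member? kind hl) ¬loop in IsHiggsLiftDM-contract kind hl 𝓕F e∈F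
IsHiggsLiftDM-minorStep kind (contractLoop e (F , 𝓕F) loop) hl =
  IsHiggsLiftDM-delete kind hl 𝓕F (loop F 𝓕F)
IsHiggsLiftDM-minorStep kind (delete e _ ¬coloop) hl =
  let F , 𝓕F , e∉F = member-∌ (IsHiggsLiftDM-member? kind hl) ¬coloop in IsHiggsLiftDM-delete kind hl 𝓕F e∉F
IsHiggsLiftDM-minorStep kind (deleteColoop e (F , 𝓕F) coloop) hl =
  IsHiggsLiftDM-contract kind hl 𝓕F (coloop F 𝓕F)

IsHiggsLiftDM-minor : ∀ kind {𝓕 : Family n} {𝓖 : Family m} → Minor 𝓕 𝓖 →
                      IsHiggsLiftDM kind 𝓕 → IsHiggsLiftDM kind 𝓖
IsHiggsLiftDM-minor kind here hl = hl
IsHiggsLiftDM-minor kind (next step minor) hl =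
  IsHiggsLiftDM-minor kind minor (IsHiggsLiftDM-minorStep kind step hl)

corollary3p5 : (kind : Kind) → ∀ {n} (𝓕 : Family n) → IsHiggsLiftDM kind 𝓕 →
    IsHiggsLiftDM kind (dual 𝓕) ×
    (∀ {m} (𝓖 : Family m) → Minor 𝓕 𝓖 → IsHiggsLiftDM kind 𝓖)
corollary3p5 kind 𝓕 hl = IsHiggsLiftDM-dual kind hl , λ 𝓖 minor → IsHiggsLiftDM-minor kind minor hl
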